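{- Let $2\le r\le n$ and let $S$ be a subgraph of $Q_n$ isomorphic to the star $K_{1,r}$. If $C$ is a connected subgraph of $Q_n-V(S)$ with $k=|V(C)|\ge 2$, then $|N_{Q_n}(V(C))\cap V(S)|\le 2(k-1)$, and equality holds only if $C$ is a star.
   Context: The $n$-dimensional hypercube $Q_n$ has as vertices all binary strings of length $n$, two strings being adjacent iff they differ in exactly one position. $K_{1,r}$ denotes the star with $r$ leaves. For a vertex set $A$ of a graph $G$, $N_G(A)=\bigcup_{x\in A}N_G(x)\setminus A$, where $N_G(x)$ is the set of neighbors of $x$. -}

module Defs where

open import Data.Bool using (Bool; true; false)
open import Data.Nat using (ℕ; zero; suc; _≟_)
open import Data.Fin using (Fin)
open import Data.Fin.Properties using (any?; all?)
open import Data.Vec using (Vec; []; _∷_)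
import Data.Vec.Properties as VecP
open import Data.Bool.Properties using () renaming (_≟_ to _≟ᵇ_)
open import Data.List using (List; _∷_; filter; length; tabulate)
open import Data.Product using (Σ; ∃; _×_; _,_)
open import Data.Sum using (_⊎_)
open import Relation.Binary.PropositionalEquality using (_≡_; _≢_)
open import Relation.Nullary using (Dec; ¬_)
open import Relation.Nullary.Decidable using (_×-dec_; ¬?)
open import Relation.Binary.Construct.Closure.ReflexiveTransitive using (Star)

Vertex : ℕ → Set
Vertex n = Vec Bool n

dist : ∀ {n} → Vertex n → Vertex n → ℕ
dist [] [] = 0
dist (x ∷ xs) (y ∷ ys) with x ≟ᵇ y
... | Relation.Nullary.yes _ = dist xs ys
... | Relation.Nullary.no  _ = suc (dist xs ys)

Adj : ∀ {n} → Vertex n → Vertex n → Set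
Adj u v = dist u v ≡ 1

Adj? : ∀ {n} (u v : Vertex n) → Dec (Adj u v)
Adj? u v = dist u v ≟ 1

_≟V_ : ∀ {n} (u v : Vertex n) → Dec (u ≡ v)
_≟V_ = VecP.≡-dec _≟ᵇ_

Injective : ∀ {k n} → (Fin k → Vertex n) → Set
Injective f = ∀ i j → f i ≡ f j → i ≡ j

-- A subgraph S of Q_n isomorphic to K_{1,r}: a centre and r distinct
-- leaves, each adjacent to the centre (edges = the r centre–leaf edges).
record StarSub (n r : ℕ) : Set where
  field
    centre     : Vertex n
    leaf       : Fin r → Vertex n
    leaf-inj   : Injective leaf
    leaf-adj   : ∀ i → Adj centre (leaf i)

-- V(S) as a duplicate-free list.
starVertices : ∀ {n r} → StarSub n r → List (Vertex n)
starVertices S = StarSub.centre S ∷ tabulate (StarSub.leaf S)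

InStar : ∀ {n r} → StarSub n r → Vertex n → Set
InStar {r = r} S x = (x ≡ StarSub.centre S) ⊎ (∃ λ (i : Fin r) → x ≡ StarSub.leaf S i)

record SubGraph (n k : ℕ) : Set₁ where
  field
    vert     : Fin k → Vertex n
    vert-inj : Injective vert
    Edge     : Fin k → Fin k → Set
    edge-sym : ∀ {i j} → Edge i j → Edge j i
    edge-adj : ∀ {i j} → Edge i j → Adj (vert i) (vert j)

Connected : ∀ {n k} → SubGraph n k → Set
Connected {k = k} C = ∀ (i j : Fin k) → Star (SubGraph.Edge C) i j

IsStarGraph : ∀ {n k} → SubGraph n k → Set
IsStarGraph {k = k} C = Σ (Fin k) λ c →
  (∀ j → j ≢ c → SubGraph.Edge C c j) ×
  (∀ i j → SubGraph.Edge C i j → (i ≡ c) ⊎ (j ≡ c))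

InNbhd : ∀ {n k} → SubGraph n k → Vertex n → Set
InNbhd {k = k} C x =
  (∃ λ (i : Fin k) → Adj (SubGraph.vert C i) x) ×
  (∀ (i : Fin k) → ¬ (SubGraph.vert C i ≡ x))

InNbhd? : ∀ {n k} (C : SubGraph n k) x → Dec (InNbhd C x)
InNbhd? C x = any? (λ i → Adj? (SubGraph.vert C i) x)
         ×-dec all? (λ i → ¬? (SubGraph.vert C i ≟V x))

nbhdInStar : ∀ {n k r} → SubGraph n k → StarSub n r → ℕ
nbhdInStar C S = length (filter (InNbhd? C) (starVertices S))

-- Q_n is bipartite and two distinct vertices of Q_n have at most two common
-- neighbours.  Call a vertex of C even if it has the parity of the centre c
-- of S.  Every leaf is a common neighbour of c and of each vertex of C
-- adjacent to it, so only even vertices see leaves, each at most two.  Being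
-- connected with an edge, C has an odd vertex y.  A second odd vertex leaves
-- at most k - 2 even ones, and |N(C) ∩ V(S)| ≤ 1 + 2(k - 2) < 2(k - 1).
-- Otherwise y is alone on its side of the bipartition of C, so C is a star
-- centred at y; if moreover c ∈ N(C), then c ~ y, and y is one more common
-- neighbour of c and each even vertex, which therefore sees at most one leaf:
-- the count is then at most 1 + (k - 1) ≤ 2(k - 1).
module Submission where

open import Defs
import Algebra.Properties.CommutativeMonoid.Sum as CommutativeMonoidSum
open import Data.Bool using (Bool; false; not; _xor_)
open import Data.Bool.Properties
  using (not-involutive; not-injective; not-¬; ¬-not; not-distribˡ-xor; not-distribʳ-xor)
  renaming (_≟_ to _≟ᵇ_)
open import Data.Empty using (⊥-elim)
open import Data.Fin using (Fin; zero; suc; punchIn; punchOut) renaming (_≟_ to _≟ᶠ_)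
open import Data.Fin.Properties using (any?; punchInᵢ≢i; punchIn-punchOut)
open import Data.List using (List; []; _∷_; filter; length; tabulate)
open import Data.List.Properties using (filter-accept; filter-reject; filter-none)
import Data.List.Relation.Unary.All as All
import Data.List.Relation.Unary.All.Properties as All
open import Data.List.Relation.Unary.All using (All; []; _∷_)
open import Data.List.Relation.Unary.Unique.Propositional using (Unique; _∷_)
import Data.List.Relation.Unary.Unique.Propositional.Properties as Unique
open import Data.Nat using (ℕ; zero; suc; pred; _≤_; _<_; _*_; _∸_; _+_; z≤n; s≤s)
open import Data.Nat.Properties
  using (+-0-commutativeMonoid; ≤-refl; ≤-trans; ≤-reflexive; ≤-pred; n≤1+n; n<1+n;
         <⇒≤; <⇒≢; +-mono-≤; +-monoˡ-≤; +-mono-<-≤; +-mono-≤-<; *-suc; module ≤-Reasoning)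
open import Data.Product using (∃; ∃₂; _×_; _,_; proj₁)
open import Data.Sum using (_⊎_; inj₁; inj₂)
open import Data.Vec using ([]; _∷_; lookup; _[_]%=_)
open import Data.Vec.Functional using (removeAt)
open import Data.Vec.Properties
  using (updateAt-updateAt; updateAt-id-local; lookup∘updateAt; lookup∘updateAt′)
open import Function using (_∘_; const)
open import Relation.Binary.Construct.Closure.ReflexiveTransitive using (Star; ε; _◅_)
open import Relation.Binary.PropositionalEquality
open import Relation.Nullary using (¬_; Dec; yes; no; contradiction)
open import Relation.Nullary.Decidable using (_×-dec_; ¬?; decidable-stable)
open import Relation.Unary using (Pred; Decidable)

open CommutativeMonoidSum +-0-commutativeMonoid using (sum; sum-syntax; sum-remove)

∑-mono-≤ : ∀ {k} {f g : Fin k → ℕ} → (∀ i → f i ≤ g i) → sum f ≤ sum g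
∑-mono-≤ {zero}  f≤g = z≤n
∑-mono-≤ {suc k} f≤g = +-mono-≤ (f≤g zero) (∑-mono-≤ (f≤g ∘ suc))

∑-mono-< : ∀ {k} {f g : Fin k → ℕ} → (∀ i → f i ≤ g i) →
           ∀ i → f i < g i → sum f < sum g
∑-mono-< f≤g zero    fi<gi = +-mono-<-≤ fi<gi (∑-mono-≤ (f≤g ∘ suc))
∑-mono-< f≤g (suc i) fi<gi = +-mono-≤-< (f≤g zero) (∑-mono-< (f≤g ∘ suc) i fi<gi)

∑-≤-* : ∀ {k m} {f : Fin k → ℕ} → (∀ i → f i ≤ m) → sum f ≤ m * k
∑-≤-* {zero}      f≤m = z≤n
∑-≤-* {suc k} {m} f≤m =
  ≤-trans (+-mono-≤ (f≤m zero) (∑-≤-* (f≤m ∘ suc))) (≤-reflexive (sym (*-suc m k)))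

∑-removeAt : ∀ {k} (f : Fin (suc k) → ℕ) {y} → f y ≡ 0 → sum f ≡ sum (removeAt f y)
∑-removeAt f {y} fy≡0 = trans (sum-remove {i = y} f) (cong (_+ sum (removeAt f y)) fy≡0)

∑-vanishing-≤ : ∀ {k m} {f : Fin (suc k) → ℕ} y → f y ≡ 0 →
                (∀ i → i ≢ y → f i ≤ m) → sum f ≤ m * k
∑-vanishing-≤ {f = f} y fy≡0 f≤m =
  ≤-trans (≤-reflexive (∑-removeAt f fy≡0))
          (∑-≤-* λ i → f≤m (punchIn y i) (punchInᵢ≢i y i))

∑-vanishing₂-≤ : ∀ {k m} {f : Fin (suc (suc k)) → ℕ} {y z} → y ≢ z →
                 f y ≡ 0 → f z ≡ 0 → (∀ i → f i ≤ m) → sum f ≤ m * k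
∑-vanishing₂-≤ {f = f} y≢z fy≡0 fz≡0 f≤m =
  ≤-trans (≤-reflexive (∑-removeAt f fy≡0))
          (∑-vanishing-≤ {f = removeAt f _} (punchOut y≢z)
                         (trans (cong f (punchIn-punchOut y≢z)) fz≡0) (λ i _ → f≤m _))

module _ {a p} {A : Set a} {P : Pred A p} (P? : Decidable P) where

  length-filter-mono-∷ : ∀ x xs → length (filter P? xs) ≤ length (filter P? (x ∷ xs))
  length-filter-mono-∷ x xs with P? x
  ... | yes _ = n≤1+n _
  ... | no  _ = ≤-refl

  length-filter-∷-≤-suc : ∀ x xs →
                          length (filter P? (x ∷ xs)) ≤ suc (length (filter P? xs))
  length-filter-∷-≤-suc x xs with P? x
  ... | yes _ = ≤-refl
  ... | no  _ = n≤1+n _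

length-filter-≤-∑ : ∀ {a p q k} {A : Set a} {P : Pred A p} {Q : Fin k → Pred A q}
                    (P? : Decidable P) (Q? : ∀ i → Decidable (Q i)) →
                    (∀ {x} → P x → ∃ λ i → Q i x) →
                    ∀ xs → length (filter P? xs) ≤ ∑[ i < k ] length (filter (Q? i) xs)
length-filter-≤-∑ P? Q? covered []       = z≤n
length-filter-≤-∑ P? Q? covered (x ∷ xs) with P? x
... | no  _ = ≤-trans (length-filter-≤-∑ P? Q? covered xs)
                      (∑-mono-≤ λ i → length-filter-mono-∷ (Q? i) x xs)
... | yes px with covered px
...   | i , qix =
  ≤-trans (s≤s (length-filter-≤-∑ P? Q? covered xs))
          (∑-mono-< (λ j → length-filter-mono-∷ (Q? j) x xs) i
                    (≤-reflexive (cong length (sym (filter-accept (Q? i) qix)))))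

flipBit : ∀ {n} → Fin n → Vertex n → Vertex n
flipBit p u = u [ p ]%= not

flipBit-involutive : ∀ {n} (p : Fin n) (u : Vertex n) → flipBit p (flipBit p u) ≡ u
flipBit-involutive p u =
  trans (updateAt-updateAt p u) (updateAt-id-local p u (not-involutive _))

dist≡0⇒≡ : ∀ {n} (u v : Vertex n) → dist u v ≡ 0 → u ≡ v
dist≡0⇒≡ []      []      _ = refl
dist≡0⇒≡ (x ∷ u) (y ∷ v) d≡0 with x ≟ᵇ y
... | yes refl = cong (x ∷_) (dist≡0⇒≡ u v d≡0)
dist≡0⇒≡ (x ∷ u) (y ∷ v) () | no _

dist-sym : ∀ {n} (u v : Vertex n) → dist u v ≡ dist v u
dist-sym []      []      = refl
dist-sym (x ∷ u) (y ∷ v) with x ≟ᵇ y | y ≟ᵇ x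
... | yes _   | yes _   = dist-sym u v
... | yes x≡y | no  y≢x = ⊥-elim (y≢x (sym x≡y))
... | no  x≢y | yes y≡x = ⊥-elim (x≢y (sym y≡x))
... | no  _   | no  _   = cong suc (dist-sym u v)

Adj-sym : ∀ {n} (u v : Vertex n) → Adj u v → Adj v u
Adj-sym u v = trans (dist-sym v u)

Adj⇒flipBit : ∀ {n} (u v : Vertex n) → Adj u v → ∃ λ p → v ≡ flipBit p u
Adj⇒flipBit []      []      ()
Adj⇒flipBit (x ∷ u) (y ∷ v) d≡1 with x ≟ᵇ y
... | yes refl = let p , v≡ = Adj⇒flipBit u v d≡1 in suc p , cong (x ∷_) v≡
... | no  x≢y  =
  zero , cong₂ _∷_ (¬-not (x≢y ∘ sym)) (sym (dist≡0⇒≡ u v (cong pred d≡1)))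

DiffersAt : ∀ {n} → Vertex n → Vertex n → Fin n → Set
DiffersAt u v j = lookup u j ≢ lookup v j

differsAt-flipBit : ∀ {n} (p : Fin n) (u : Vertex n) → DiffersAt u (flipBit p u) p
differsAt-flipBit p u eq = not-¬ refl (trans eq (lookup∘updateAt p u))

differsAt-flipBit⇒≡ : ∀ {n} {p j : Fin n} (u : Vertex n) →
                      DiffersAt u (flipBit p u) j → j ≡ p
differsAt-flipBit⇒≡ {p = p} {j} u d with j ≟ᶠ p
... | yes j≡p = j≡p
... | no  j≢p = ⊥-elim (d (sym (lookup∘updateAt′ j p j≢p u)))

differsAt-split : ∀ {n} (u w v : Vertex n) {j} →
                  DiffersAt u v j → DiffersAt u w j ⊎ DiffersAt w v j
differsAt-split u w v {j} d with lookup u j ≟ᵇ lookup w j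
... | yes uj≡wj = inj₂ (d ∘ trans uj≡wj)
... | no  uj≢wj = inj₁ uj≢wj

CommonNeighbour : ∀ {n} → Vertex n → Vertex n → Vertex n → Set
CommonNeighbour u v w = Adj u w × Adj v w

commonNeighbour-positions :
  ∀ {n} {u v w : Vertex n} → u ≢ v → CommonNeighbour u v w →
  ∃₂ λ p q → w ≡ flipBit p u × DiffersAt u v p ×
             (∀ j → DiffersAt u v j → j ≡ p ⊎ j ≡ q)
commonNeighbour-positions {u = u} {v} {w} u≢v (uw , vw)
  with Adj⇒flipBit u w uw | Adj⇒flipBit w v (Adj-sym v w vw)
... | p , refl | q , refl = p , q , refl , differs-p , only-p-q
  where
  differs-p : DiffersAt u (flipBit q (flipBit p u)) p
  differs-p with p ≟ᶠ q
  ... | yes refl = ⊥-elim (u≢v (sym (flipBit-involutive p u)))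
  ... | no  p≢q  = λ eq →
    differsAt-flipBit p u (trans eq (lookup∘updateAt′ p q p≢q (flipBit p u)))
  only-p-q : ∀ j → DiffersAt u (flipBit q (flipBit p u)) j → j ≡ p ⊎ j ≡ q
  only-p-q j d with differsAt-split u (flipBit p u) (flipBit q (flipBit p u)) d
  ... | inj₁ d₁ = inj₁ (differsAt-flipBit⇒≡ u d₁)
  ... | inj₂ d₂ = inj₂ (differsAt-flipBit⇒≡ (flipBit p u) d₂)

length-commonNeighbours≤2 : ∀ {n} {u v : Vertex n} {ws} → u ≢ v → Unique ws →
                            All (CommonNeighbour u v) ws → length ws ≤ 2
length-commonNeighbours≤2 _ _ [] = z≤n
length-commonNeighbours≤2 _ _ (_ ∷ []) = s≤s z≤n
length-commonNeighbours≤2 _ _ (_ ∷ _ ∷ []) = s≤s (s≤s z≤n)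
length-commonNeighbours≤2 {u = u} {v} {a ∷ _} u≢v
  ((a≢b ∷ a≢d ∷ _) ∷ (b≢d ∷ _) ∷ _) (na ∷ nb ∷ nd ∷ _)
  with commonNeighbour-positions u≢v na
... | pa , qa , a≡ , _ , only-pa-qa =
  -- u and v differ only at pa and qa, and a = flipBit pa u, so every other
  -- common neighbour is flipBit qa u.
  ⊥-elim (b≢d (trans (at-qa nb a≢b) (sym (at-qa nd a≢d))))
  where
  at-qa : ∀ {w} → CommonNeighbour u v w → a ≢ w → w ≡ flipBit qa u
  at-qa nw a≢w with commonNeighbour-positions u≢v nw
  ... | p , _ , refl , differs-p , _ with only-pa-qa p differs-p
  ...   | inj₁ refl = ⊥-elim (a≢w a≡)
  ...   | inj₂ refl = refl

parity : ∀ {n} → Vertex n → Bool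
parity []      = false
parity (x ∷ u) = x xor parity u

parity-flipBit : ∀ {n} (p : Fin n) (u : Vertex n) → parity (flipBit p u) ≡ not (parity u)
parity-flipBit zero    (x ∷ u) = sym (not-distribˡ-xor x (parity u))
parity-flipBit (suc p) (x ∷ u) =
  trans (cong (x xor_) (parity-flipBit p u)) (sym (not-distribʳ-xor x (parity u)))

Adj⇒parity-not : ∀ {n} (u v : Vertex n) → Adj u v → parity v ≡ not (parity u)
Adj⇒parity-not u v uv with Adj⇒flipBit u v uv
... | p , refl = parity-flipBit p u

Adj⇒parity≢ : ∀ {n} (u v : Vertex n) → Adj u v → parity u ≢ parity v
Adj⇒parity≢ u v uv pu≡pv = not-¬ refl (trans pu≡pv (Adj⇒parity-not u v uv))

commonNeighbour⇒parity≡ : ∀ {n} (u v w : Vertex n) →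
                          CommonNeighbour u v w → parity u ≡ parity v
commonNeighbour⇒parity≡ u v w (uw , vw) =
  not-injective (trans (sym (Adj⇒parity-not u w uw)) (Adj⇒parity-not v w vw))

Star⇒step : ∀ {a ℓ} {A : Set a} {R : A → A → Set ℓ} {i j} → i ≢ j → Star R i j → ∃ (R i)
Star⇒step i≢i ε       = ⊥-elim (i≢i refl)
Star⇒step _   (r ◅ _) = _ , r

module SingletonSide {n k} (C : SubGraph n k) (connected : Connected C) {P : Fin k → Set}
                     (bipartite : ∀ {i j} → SubGraph.Edge C i j → P i → ¬ P j)
                     (y : Fin k) (others : ∀ i → i ≢ y → P i) where
  open SubGraph C

  ¬P⇒≡y : ∀ {i} → ¬ P i → i ≡ y
  ¬P⇒≡y {i} ¬Pi with i ≟ᶠ y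
  ... | yes i≡y = i≡y
  ... | no  i≢y = ⊥-elim (¬Pi (others i i≢y))

  edge-to-y : ∀ i → i ≢ y → Edge i y
  edge-to-y i i≢y with Star⇒step i≢y (connected i y)
  ... | l , e = subst (Edge i) (¬P⇒≡y (bipartite e (others i i≢y))) e

  isStarGraph : IsStarGraph C
  isStarGraph = y , (λ j j≢y → edge-sym (edge-to-y j j≢y)) , ends
    where
    ends : ∀ i j → Edge i j → (i ≡ y) ⊎ (j ≡ y)
    ends i j e with i ≟ᶠ y
    ... | yes i≡y = inj₁ i≡y
    ... | no  i≢y = inj₂ (¬P⇒≡y (bipartite e (others i i≢y)))

module StarAndComponent {n r k} (S : StarSub n r) (C : SubGraph n (suc (suc k)))
                        (disjoint : ∀ i → ¬ InStar S (SubGraph.vert C i)) where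
  open StarSub S
  open SubGraph C

  leaves : List (Vertex n)
  leaves = tabulate leaf

  adjacentLeaves : Fin (suc (suc k)) → List (Vertex n)
  adjacentLeaves i = filter (Adj? (vert i)) leaves

  Even : Fin (suc (suc k)) → Set
  Even i = parity (vert i) ≡ parity centre

  even? : ∀ i → Dec (Even i)
  even? i = parity (vert i) ≟ᵇ parity centre

  ∑adjacentLeaves : ℕ
  ∑adjacentLeaves = ∑[ i < suc (suc k) ] length (adjacentLeaves i)

  nbhdInStar≤ : nbhdInStar C S ≤ suc ∑adjacentLeaves
  nbhdInStar≤ = ≤-trans (length-filter-∷-≤-suc (InNbhd? C) centre leaves)
                        (s≤s (length-filter-≤-∑ (InNbhd? C) (Adj? ∘ vert) proj₁ leaves))

  centre∉⇒nbhdInStar≤ : ¬ InNbhd C centre → nbhdInStar C S ≤ ∑adjacentLeaves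
  centre∉⇒nbhdInStar≤ centre∉ =
    ≤-trans (≤-reflexive (cong length (filter-reject (InNbhd? C) centre∉)))
            (length-filter-≤-∑ (InNbhd? C) (Adj? ∘ vert) proj₁ leaves)

  adjacentLeaves-unique : ∀ i → Unique (adjacentLeaves i)
  adjacentLeaves-unique i = Unique.filter⁺ (Adj? (vert i)) (Unique.tabulate⁺ (leaf-inj _ _))

  adjacentLeaves-common : ∀ i → All (CommonNeighbour (vert i) centre) (adjacentLeaves i)
  adjacentLeaves-common i = All.zip (All.all-filter (Adj? (vert i)) leaves ,
                                     All.filter⁺ (Adj? (vert i)) (All.tabulate⁺ leaf-adj))

  vert≢centre : ∀ i → vert i ≢ centre
  vert≢centre i = disjoint i ∘ inj₁

  length-adjacentLeaves≤2 : ∀ i → length (adjacentLeaves i) ≤ 2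
  length-adjacentLeaves≤2 i =
    length-commonNeighbours≤2 (vert≢centre i) (adjacentLeaves-unique i)
                              (adjacentLeaves-common i)

  length-adjacentLeaves≤1 : ∀ i w → CommonNeighbour (vert i) centre w → (∀ j → w ≢ leaf j) →
                            length (adjacentLeaves i) ≤ 1
  length-adjacentLeaves≤1 i w common w∉leaves =
    ≤-pred (length-commonNeighbours≤2 (vert≢centre i)
             (All.filter⁺ (Adj? (vert i)) (All.tabulate⁺ w∉leaves)
               ∷ adjacentLeaves-unique i)
             (common ∷ adjacentLeaves-common i))

  length-adjacentLeaves-odd : ∀ i → ¬ Even i → length (adjacentLeaves i) ≡ 0
  length-adjacentLeaves-odd i odd =
    cong length (filter-none (Adj? (vert i)) (All.tabulate⁺ λ j adj →
      odd (commonNeighbour⇒parity≡ (vert i) centre (leaf j) (adj , leaf-adj j))))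

  edge⇒¬bothEven : ∀ {i j} → Edge i j → Even i → ¬ Even j
  edge⇒¬bothEven {i} {j} e even-i even-j =
    Adj⇒parity≢ (vert i) (vert j) (edge-adj e) (trans even-i (sym even-j))

  oddVertex : Connected C → ∃ λ y → ¬ Even y
  oddVertex connected with Star⇒step (λ ()) (connected zero (suc zero))
  ... | l , e with even? zero
  ...   | yes even-0 = l , edge⇒¬bothEven e even-0
  ...   | no  odd-0  = zero , odd-0

  twoOdd⇒nbhdInStar< : ∀ {y z} → y ≢ z → ¬ Even y → ¬ Even z → nbhdInStar C S < 2 * suc k
  twoOdd⇒nbhdInStar< y≢z odd-y odd-z = begin-strict
    nbhdInStar C S    ≤⟨ nbhdInStar≤ ⟩
    suc ∑adjacentLeaves
      ≤⟨ s≤s (∑-vanishing₂-≤ y≢z (length-adjacentLeaves-odd _ odd-y)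
                                 (length-adjacentLeaves-odd _ odd-z) length-adjacentLeaves≤2) ⟩
    suc (2 * k)       <⟨ n<1+n _ ⟩
    2 + 2 * k         ≡⟨ sym (*-suc 2 k) ⟩
    2 * suc k         ∎
    where open ≤-Reasoning

  oneOdd⇒nbhdInStar≤ : Connected C → ∀ {y} → ¬ Even y → (∀ i → i ≢ y → Even i) →
                       nbhdInStar C S ≤ 2 * suc k
  oneOdd⇒nbhdInStar≤ connected {y} odd-y others with InNbhd? C centre
  ... | no centre∉ = begin
    nbhdInStar C S    ≤⟨ centre∉⇒nbhdInStar≤ centre∉ ⟩
    ∑adjacentLeaves   ≤⟨ ∑-vanishing-≤ y (length-adjacentLeaves-odd y odd-y)
                                       (λ i _ → length-adjacentLeaves≤2 i) ⟩
    2 * suc k         ∎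
    where open ≤-Reasoning
  ... | yes ((x , x~c) , _) = begin
    nbhdInStar C S    ≤⟨ nbhdInStar≤ ⟩
    suc ∑adjacentLeaves
      ≤⟨ s≤s (∑-vanishing-≤ y (length-adjacentLeaves-odd y odd-y) λ i i≢y →
                length-adjacentLeaves≤1 i (vert y) (edge-adj (edge-to-y i i≢y) , c~y)
                                        y∉leaves) ⟩
    1 + 1 * suc k     ≤⟨ +-monoˡ-≤ (1 * suc k) (s≤s z≤n) ⟩
    2 * suc k         ∎
    where
    open ≤-Reasoning
    open SingletonSide C connected edge⇒¬bothEven y others
    x≡y : x ≡ y
    x≡y = ¬P⇒≡y (Adj⇒parity≢ (vert x) centre x~c)
    c~y : Adj centre (vert y)
    c~y = Adj-sym (vert y) centre (subst (λ x → Adj (vert x) centre) x≡y x~c)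
    y∉leaves : ∀ j → vert y ≢ leaf j
    y∉leaves j = disjoint y ∘ inj₂ ∘ (j ,_)

lemma3p4 : (n r : ℕ) → 2 ≤ r → r ≤ n → (S : StarSub n r) →
           (k : ℕ) → 2 ≤ k → (C : SubGraph n k) → Connected C →
           (∀ (i : Fin k) → ¬ InStar S (SubGraph.vert C i)) →
           (nbhdInStar C S ≤ 2 * (k ∸ 1)) ×
           (nbhdInStar C S ≡ 2 * (k ∸ 1) → IsStarGraph C)
lemma3p4 _ _ _ _ _ 0             ()          _ _ _
lemma3p4 _ _ _ _ _ 1             (s≤s ())    _ _ _
lemma3p4 _ _ _ _ S (suc (suc k)) _ C connected disjoint = bounds (oddVertex connected)
  where
  open StarAndComponent S C disjoint
  bounds : ∃ (λ y → ¬ Even y) →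
           (nbhdInStar C S ≤ 2 * suc k) × (nbhdInStar C S ≡ 2 * suc k → IsStarGraph C)
  bounds (y , odd-y) with any? (λ z → ¬? (z ≟ᶠ y) ×-dec ¬? (even? z))
  ... | yes (z , z≢y , odd-z) = <⇒≤ N< , λ N≡ → contradiction N≡ (<⇒≢ N<)
    where
    N< : nbhdInStar C S < 2 * suc k
    N< = twoOdd⇒nbhdInStar< (z≢y ∘ sym) odd-y odd-z
  ... | no no-second-odd = oneOdd⇒nbhdInStar≤ connected odd-y others , const isStarGraph
    where
    others : ∀ i → i ≢ y → Even i
    others i i≢y = decidable-stable (even? i) λ odd-i → no-second-odd (i , i≢y , odd-i)
    open SingletonSide C connected edge⇒¬bothEven y others
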